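{- Let $G=(V,E)$ be a locally finite simple $C_4$-free graph. If a vertex $x\in V$ is contained in a triangle and $d_x\ge 3$, then the punctured $2$-ball $\mathring{B}_2(x)$ has more than one connected component.
   Context: $G$ is $C_4$-free if it contains no $4$-cycle as a subgraph; $d_x$ is the degree of $x$. With $d$ the combinatorial graph distance, $S_k(x)=\{y: d(x,y)=k\}$. The punctured $2$-ball $\mathring{B}_2(x)$ is the subgraph with vertex set $S_1(x)\cup S_2(x)$ whose edges are all edges of $G$ with both endpoints in $S_1(x)$ together with all edges of $G$ between $S_1(x)$ and $S_2(x)$ (edges with both endpoints in $S_2(x)$ are not included). -}

module Defs where

open import Data.Nat using (ℕ; zero; suc; _<_)
open import Data.List using (List; length)
open import Data.List.Membership.Propositional using (_∈_)
open import Data.List.Relation.Unary.Unique.Propositional using (Unique)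
open import Data.Product using (Σ; ∃; _×_; _,_)
open import Data.Sum using (_⊎_)
open import Data.Empty using (⊥)
open import Relation.Nullary using (¬_)
open import Relation.Binary.PropositionalEquality using (_≡_; _≢_)
open import Relation.Binary.Construct.Closure.ReflexiveTransitive using (Star)
open import Function.Bundles using (_⇔_)

record SimpleGraph : Set₁ where
  field
    V     : Set
    E     : V → V → Set
    sym   : ∀ {x y} → E x y → E y x
    irref : ∀ {x} → ¬ E x x

module _ (G : SimpleGraph) where
  open SimpleGraph G

  LocallyFinite : Set
  LocallyFinite = ∀ x → Σ (List V) λ ns → Unique ns × (∀ y → (y ∈ ns) ⇔ E x y)

  degree : LocallyFinite → V → ℕ
  degree lf x with lf x
  ... | ns , _ = length ns

  C4Free : Set
  C4Free = ∀ a b c d → a ≢ b → a ≢ c → a ≢ d → b ≢ c → b ≢ d → c ≢ d →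
           E a b → E b c → E c d → E d a → ⊥

  InTriangle : V → Set
  InTriangle x = ∃ λ y → ∃ λ z → E x y × E y z × E z x

  data Walk : V → V → ℕ → Set where
    nil  : ∀ {x} → Walk x x zero
    cons : ∀ {x y z n} → E x y → Walk y z n → Walk x z (suc n)

  Dist : V → V → ℕ → Set
  Dist x y k = Walk x y k × (∀ m → m < k → ¬ Walk x y m)

  S : ℕ → V → V → Set
  S k x y = Dist x y k

  B₂°-vertex : V → V → Set
  B₂°-vertex x u = S 1 x u ⊎ S 2 x u

  B₂°-edge : V → V → V → Set
  B₂°-edge x u v = E u v ×
    ((S 1 x u × S 1 x v) ⊎ (S 1 x u × S 2 x v) ⊎ (S 2 x u × S 1 x v))

  B₂°-connected : V → V → V → Set
  B₂°-connected x = Star (B₂°-edge x)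

  B₂°-disconnected : V → Set
  B₂°-disconnected x = ∃ λ u → ∃ λ v →
    B₂°-vertex x u × B₂°-vertex x v × ¬ B₂°-connected x u v

-- Let y, z be the other two vertices of a triangle at x, and let the wing of
-- yz consist of y, z and the vertices of S₂(x) adjacent to y or z. In a C₄-free
-- graph two distinct vertices have at most one common neighbour, so the only
-- neighbour of y in S₁(x) is z (and vice versa), and the only neighbour in
-- S₁(x) of a vertex of S₂(x) adjacent to y (or z) is y (or z). Hence the wing is
-- closed under the edges of the punctured 2-ball, and a third neighbour of x,
-- which exists since d_x ≥ 3, lies outside the component of y.
module Submission where

open import Defs
open import Data.Nat using (zero; suc; _≤_; _≥_; s≤s; z≤n)
open import Data.Fin using (Fin; zero; suc; _≟_)
open import Data.List using (List; length; lookup)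
open import Data.List.Relation.Unary.All as All using ()
open import Data.List.Relation.Unary.AllPairs using (_∷_)
open import Data.List.Relation.Unary.Any using (index)
open import Data.List.Relation.Unary.Any.Properties using (lookup-index)
open import Data.List.Relation.Unary.Unique.Propositional using (Unique)
open import Data.List.Membership.Propositional using (_∈_)
open import Data.List.Membership.Propositional.Properties using (∈-lookup)
open import Data.Product using (∃; _×_; _,_; map₂; swap)
open import Data.Sum using (_⊎_; inj₁; inj₂)
open import Relation.Nullary using (¬_; yes; no; contradiction)
open import Relation.Binary.PropositionalEquality using (_≡_; _≢_; refl; sym; trans; cong)
open import Relation.Binary.Construct.Closure.ReflexiveTransitive using (ε; _◅_)
open import Function.Bundles using (Equivalence)

nonzero-avoiding : ∀ {k} (j : Fin (suc (suc (suc k)))) → ∃ λ l → l ≢ zero × l ≢ j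
nonzero-avoiding j with suc zero ≟ j
... | no 1≢j   = suc zero , (λ ()) , 1≢j
... | yes refl = suc (suc zero) , (λ ()) , (λ ())

third-index : ∀ {n} → 3 ≤ n → (i j : Fin n) → ∃ λ l → l ≢ i × l ≢ j
third-index (s≤s (s≤s (s≤s _))) i j with zero ≟ i | zero ≟ j
... | no 0≢i   | no 0≢j   = zero , 0≢i , 0≢j
... | yes refl | _        = nonzero-avoiding j
... | no _     | yes refl = map₂ swap (nonzero-avoiding i)

module _ {A : Set} where

  Unique⇒lookup-injective : ∀ {xs : List A} → Unique xs →
                            ∀ i j → lookup xs i ≡ lookup xs j → i ≡ j
  Unique⇒lookup-injective (_  ∷ _) zero    zero    _  = refl
  Unique⇒lookup-injective (≢s ∷ _) zero    (suc j) eq = contradiction eq (All.lookup ≢s (∈-lookup j))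
  Unique⇒lookup-injective (≢s ∷ _) (suc i) zero    eq = contradiction (sym eq) (All.lookup ≢s (∈-lookup i))
  Unique⇒lookup-injective (_  ∷ u) (suc i) (suc j) eq = cong suc (Unique⇒lookup-injective u i j eq)

  third-member : ∀ {xs : List A} {a b} → Unique xs → 3 ≤ length xs → a ∈ xs → b ∈ xs →
                 ∃ λ c → c ∈ xs × c ≢ a × c ≢ b
  third-member {xs} uniq len a∈xs b∈xs with third-index len (index a∈xs) (index b∈xs)
  ... | l , l≢a , l≢b = lookup xs l , ∈-lookup l , lookup-≢ a∈xs l≢a , lookup-≢ b∈xs l≢b
    where
    lookup-≢ : ∀ {l c} (c∈xs : c ∈ xs) → l ≢ index c∈xs → lookup xs l ≢ c
    lookup-≢ c∈xs l≢ eq = l≢ (Unique⇒lookup-injective uniq _ _ (trans eq (lookup-index c∈xs)))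

module _ (G : SimpleGraph) where
  open SimpleGraph G renaming (sym to E-sym)

  E⇒≢ : ∀ {u v} → E u v → u ≢ v
  E⇒≢ e refl = irref e

  E⇒S₁ : ∀ {x u} → E x u → S G 1 x u
  E⇒S₁ e = cons e nil , λ { zero _ nil → irref e ; (suc _) (s≤s ()) _ }

  S₁⇒E : ∀ {x u} → S G 1 x u → E x u
  S₁⇒E (cons e nil , _) = e

  S₂⇒¬E : ∀ {x u} → S G 2 x u → ¬ E x u
  S₂⇒¬E (_ , shorter) e = shorter 1 (s≤s (s≤s z≤n)) (cons e nil)

  S₂⇒≢ : ∀ {x u} → S G 2 x u → x ≢ u
  S₂⇒≢ (_ , shorter) refl = shorter 0 (s≤s z≤n) nil

  common-neighbours-equal : C4Free G → ∀ {x y v w} → x ≢ y →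
                            E x v → E v y → E x w → E w y → ¬ ¬ v ≡ w
  common-neighbours-equal c4 x≢y exv evy exw ewy v≢w =
    c4 _ _ _ _ (E⇒≢ exv) x≢y (E⇒≢ exw) (E⇒≢ evy) v≢w (E⇒≢ (E-sym ewy))
       exv evy (E-sym ewy) (E-sym exw)

  Wing : V → V → V → V → Set
  Wing x y z u = u ≡ y ⊎ u ≡ z ⊎ (S G 2 x u × (E u y ⊎ E u z))

  module _ (c4 : C4Free G) {x y z} (exy : E x y) (eyz : E y z) (ezx : E z x) where

    Wing-step : ∀ {u v} → B₂°-edge G x u v → Wing x y z u → ¬ ¬ Wing x y z v
    Wing-step (euv , inj₁ (_ , s₁v)) (inj₁ refl) ¬wv =
      common-neighbours-equal c4 (E⇒≢ exy) (S₁⇒E s₁v) (E-sym euv) (E-sym ezx) (E-sym eyz)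
        (λ v≡z → ¬wv (inj₂ (inj₁ v≡z)))
    Wing-step (euv , inj₁ (_ , s₁v)) (inj₂ (inj₁ refl)) ¬wv =
      common-neighbours-equal c4 (E⇒≢ (E-sym ezx)) (S₁⇒E s₁v) (E-sym euv) exy eyz
        (λ v≡y → ¬wv (inj₁ v≡y))
    Wing-step (euv , inj₂ (inj₁ (_ , s₂v))) (inj₁ refl) ¬wv =
      ¬wv (inj₂ (inj₂ (s₂v , inj₁ (E-sym euv))))
    Wing-step (euv , inj₂ (inj₁ (_ , s₂v))) (inj₂ (inj₁ refl)) ¬wv =
      ¬wv (inj₂ (inj₂ (s₂v , inj₂ (E-sym euv))))
    Wing-step (_ , inj₂ (inj₂ (s₂u , _))) (inj₁ refl) _ = S₂⇒¬E s₂u exy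
    Wing-step (_ , inj₂ (inj₂ (s₂u , _))) (inj₂ (inj₁ refl)) _ = S₂⇒¬E s₂u (E-sym ezx)
    Wing-step (_ , inj₁ (s₁u , _)) (inj₂ (inj₂ (s₂u , _))) _ = S₂⇒¬E s₂u (S₁⇒E s₁u)
    Wing-step (_ , inj₂ (inj₁ (s₁u , _))) (inj₂ (inj₂ (s₂u , _))) _ = S₂⇒¬E s₂u (S₁⇒E s₁u)
    Wing-step (euv , inj₂ (inj₂ (_ , s₁v))) (inj₂ (inj₂ (s₂u , inj₁ euy))) ¬wv =
      common-neighbours-equal c4 (S₂⇒≢ s₂u) (S₁⇒E s₁v) (E-sym euv) exy (E-sym euy)
        (λ v≡y → ¬wv (inj₁ v≡y))
    Wing-step (euv , inj₂ (inj₂ (_ , s₁v))) (inj₂ (inj₂ (s₂u , inj₂ euz))) ¬wv =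
      common-neighbours-equal c4 (S₂⇒≢ s₂u) (S₁⇒E s₁v) (E-sym euv) (E-sym ezx) (E-sym euz)
        (λ v≡z → ¬wv (inj₂ (inj₁ v≡z)))

    -- Equality on V is not decidable, so closure holds only up to ¬ ¬; this
    -- suffices because separation is a negative statement.
    Wing-closed : ∀ {u v} → B₂°-connected G x u v → Wing x y z u → ¬ ¬ Wing x y z v
    Wing-closed ε       wu ¬wv = ¬wv wu
    Wing-closed (e ◅ p) wu ¬wv = Wing-step e wu (λ wv → Wing-closed p wv ¬wv)

    third-neighbour-separated : ∀ {w} → E x w → w ≢ y → w ≢ z → ¬ B₂°-connected G x y w
    third-neighbour-separated exw w≢y w≢z p = Wing-closed p (inj₁ refl) λ
      { (inj₁ w≡y)             → w≢y w≡y
      ; (inj₂ (inj₁ w≡z))      → w≢z w≡z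
      ; (inj₂ (inj₂ (s₂w , _))) → S₂⇒¬E s₂w exw }

lemma3p2 : (G : SimpleGraph) (lf : LocallyFinite G) → C4Free G →
           (x : SimpleGraph.V G) → InTriangle G x → degree G lf x ≥ 3 →
           B₂°-disconnected G x
lemma3p2 G lf c4 x (y , z , exy , eyz , ezx) deg with lf x
... | ns , uniq , ns≡N[x] with third-member uniq deg (neighbour exy) (neighbour (E-sym ezx))
  where
  open SimpleGraph G renaming (sym to E-sym)
  neighbour : ∀ {u} → E x u → u ∈ ns
  neighbour = Equivalence.from (ns≡N[x] _)
... | w , w∈ns , w≢y , w≢z =
  y , w , inj₁ (E⇒S₁ G exy) , inj₁ (E⇒S₁ G exw) ,
  third-neighbour-separated G c4 exy eyz ezx exw w≢y w≢z
  where
  exw : SimpleGraph.E G x w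
  exw = Equivalence.to (ns≡N[x] w) w∈ns
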